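{- Let $r\geq 3$, let $X$ be a finite set of cardinality $n\ge 1$, and let $A_{1},\dots,A_{r}$ be subsets of $X$. For $k\in\{1,\dots,r\}$ set \[ S_{k}=\sum_{1\leq i_{1}<\dots<i_{k}\leq r}\left|A_{i_{1}}\cap\dots\cap A_{i_{k}}\right|. \] Then for every $1\leq k\leq r$, \[ S_{k}\geq\binom{\lfloor S_{1}/n\rfloor}{k-1}\left(S_{1}-\frac{k-1}{k}\left(\lfloor S_{1}/n\rfloor+1\right)n\right). \]
   Context: $\binom{m}{j}$ denotes the usual binomial coefficient for nonnegative integers $m,j$ (equal to $0$ when $j>m$). -}

module Defs where

open import Data.Nat using (ℕ; zero; suc; _≟_)
open import Data.Fin using (Fin)
open import Data.Fin.Subset using (Subset; ⋂; ∣_∣; outside; inside)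
open import Data.Fin.Subset.Properties using (_∈?_)
open import Data.List using (List; []; _∷_; map; filter; allFin; _++_)
open import Data.Nat.ListAction using (sum)
open import Data.Vec using (_∷_; [])
open import Relation.Unary using (Decidable)

allSubsets : (r : ℕ) → List (Subset r)
allSubsets zero = [] ∷ []
allSubsets (suc r) = map (outside ∷_) (allSubsets r) ++ map (inside ∷_) (allSubsets r)

members : {r : ℕ} → Subset r → List (Fin r)
members {r} I = filter (_∈? I) (allFin r)

-- ⋂_{i ∈ I} A_i  (the empty intersection is the whole ground set X = Fin n).
interAt : {n r : ℕ} → (Fin r → Subset n) → Subset r → Subset n
interAt A I = ⋂ (map A (members I))

subsetsOfSize : (r k : ℕ) → List (Subset r)
subsetsOfSize r k = filter (λ I → ∣ I ∣ ≟ k) (allSubsets r)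

S : {n r : ℕ} → (Fin r → Subset n) → ℕ → ℕ
S {n} {r} A k = sum (map (λ I → ∣ interAt A I ∣) (subsetsOfSize r k))

-- Let d(x) be the number of sets A i containing the point x. Then S_k = Σ_x C(d(x), k),
-- in particular S_1 = Σ_x d(x). The convex function d ↦ C(d, k) lies above the line
-- through its values at q and q + 1, whose slope is C(q, k−1); combined with
-- k·C(q, k) = (q−k+1)·C(q, k−1) this gives k·C(d, k) ≥ C(q, k−1)·(k·d − (k−1)(q+1))
-- at every point. Summing over the n points proves the inequality for every q ∈ ℕ, and
-- the theorem takes q = ⌊S_1/n⌋.
module Submission where

module BinomialCoefficients where

  open import Data.Nat using (ℕ; zero; suc; _+_; _*_; _≤_)
  open import Data.Nat.Properties
    using (≤-refl; ≤-trans; ≤-total; m≤n+m; m≤n⇒∃[o]m+o≡n; +-identityʳ; +-suc; *-zeroʳ; *-distribʳ-+;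
           +-mono-≤; +-monoˡ-≤; +-monoʳ-≤; *-monoʳ-≤; +-cancelʳ-≤; +-commutativeSemigroup;
           module ≤-Reasoning)
  open import Data.Nat.Combinatorics using (_C_; nCk+nC[k+1]≡[n+1]C[k+1]; nC1≡n)
  open import Data.Nat.Tactic.RingSolver using (solve)
  open import Algebra.Properties.CommutativeSemigroup +-commutativeSemigroup
    using (x∙yz≈y∙xz; x∙yz≈xz∙y; xy∙z≈x∙zy)
  open import Data.List using ([]; _∷_)
  open import Data.Product using (_,_)
  open import Data.Sum using (inj₁; inj₂)
  open import Relation.Binary.PropositionalEquality

  nCk≤[1+n]Ck : ∀ n k → n C k ≤ suc n C k
  nCk≤[1+n]Ck n zero = ≤-refl
  nCk≤[1+n]Ck n (suc k) = begin
    n C suc k          ≤⟨ m≤n+m (n C suc k) (n C k) ⟩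
    n C k + n C suc k  ≡⟨ nCk+nC[k+1]≡[n+1]C[k+1] n k ⟩
    suc n C suc k      ∎
    where open ≤-Reasoning

  nCk≤[n+t]Ck : ∀ n t k → n C k ≤ (n + t) C k
  nCk≤[n+t]Ck n zero    k rewrite +-identityʳ n = ≤-refl
  nCk≤[n+t]Ck n (suc t) k rewrite +-suc n t =
    ≤-trans (nCk≤[n+t]Ck n t k) (nCk≤[1+n]Ck (n + t) k)

  nC[1+k]+t*nCk≤[n+t]C[1+k] : ∀ n t k → n C suc k + t * (n C k) ≤ (n + t) C suc k
  nC[1+k]+t*nCk≤[n+t]C[1+k] n zero k rewrite +-identityʳ n | +-identityʳ (n C suc k) = ≤-refl
  nC[1+k]+t*nCk≤[n+t]C[1+k] n (suc t) k = begin
    n C suc k + suc t * (n C k)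
      ≡⟨ x∙yz≈y∙xz (n C suc k) (n C k) (t * (n C k)) ⟩
    n C k + (n C suc k + t * (n C k))
      ≤⟨ +-mono-≤ (nCk≤[n+t]Ck n t k) (nC[1+k]+t*nCk≤[n+t]C[1+k] n t k) ⟩
    (n + t) C k + (n + t) C suc k
      ≡⟨ nCk+nC[k+1]≡[n+1]C[k+1] (n + t) k ⟩
    suc (n + t) C suc k
      ≡⟨ cong (_C suc k) (+-suc n t) ⟨
    (n + suc t) C suc k ∎
    where open ≤-Reasoning

  [n+t]C[1+k]≤nC[1+k]+t*[n+t]Ck : ∀ n t k → (n + t) C suc k ≤ n C suc k + t * ((n + t) C k)
  [n+t]C[1+k]≤nC[1+k]+t*[n+t]Ck n zero k rewrite +-identityʳ n | +-identityʳ (n C suc k) = ≤-refl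
  [n+t]C[1+k]≤nC[1+k]+t*[n+t]Ck n (suc t) k = begin
    (n + suc t) C suc k
      ≡⟨ cong (_C suc k) (+-suc n t) ⟩
    suc (n + t) C suc k
      ≡⟨ nCk+nC[k+1]≡[n+1]C[k+1] (n + t) k ⟨
    (n + t) C k + (n + t) C suc k
      ≤⟨ +-monoʳ-≤ ((n + t) C k) ([n+t]C[1+k]≤nC[1+k]+t*[n+t]Ck n t k) ⟩
    (n + t) C k + (n C suc k + t * ((n + t) C k))
      ≡⟨ x∙yz≈y∙xz ((n + t) C k) (n C suc k) (t * ((n + t) C k)) ⟩
    n C suc k + suc t * ((n + t) C k)
      ≤⟨ +-monoʳ-≤ (n C suc k) (*-monoʳ-≤ (suc t) (nCk≤[1+n]Ck (n + t) k)) ⟩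
    n C suc k + suc t * (suc (n + t) C k)
      ≡⟨ cong (λ x → n C suc k + suc t * (x C k)) (+-suc n t) ⟨
    n C suc k + suc t * ((n + suc t) C k) ∎
    where open ≤-Reasoning

  -- The chord of m ↦ m C (1+k) over [n, n+1] has slope n C k; by convexity the
  -- line through it lies below the whole graph.
  nC[1+k]+m*nCk≤mC[1+k]+n*nCk : ∀ n m k → n C suc k + m * (n C k) ≤ m C suc k + n * (n C k)
  nC[1+k]+m*nCk≤mC[1+k]+n*nCk n m k with ≤-total n m
  ... | inj₁ n≤m with t , refl ← m≤n⇒∃[o]m+o≡n n≤m = begin
    n C suc k + (n + t) * (n C k)
      ≡⟨ cong (n C suc k +_) (*-distribʳ-+ (n C k) n t) ⟩
    n C suc k + (n * (n C k) + t * (n C k))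
      ≡⟨ x∙yz≈xz∙y (n C suc k) (n * (n C k)) (t * (n C k)) ⟩
    (n C suc k + t * (n C k)) + n * (n C k)
      ≤⟨ +-monoˡ-≤ (n * (n C k)) (nC[1+k]+t*nCk≤[n+t]C[1+k] n t k) ⟩
    (n + t) C suc k + n * (n C k) ∎
    where open ≤-Reasoning
  ... | inj₂ m≤n with t , refl ← m≤n⇒∃[o]m+o≡n m≤n = begin
    (m + t) C suc k + m * ((m + t) C k)
      ≤⟨ +-monoˡ-≤ (m * ((m + t) C k)) ([n+t]C[1+k]≤nC[1+k]+t*[n+t]Ck m t k) ⟩
    (m C suc k + t * ((m + t) C k)) + m * ((m + t) C k)
      ≡⟨ xy∙z≈x∙zy (m C suc k) (t * ((m + t) C k)) (m * ((m + t) C k)) ⟩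
    m C suc k + (m * ((m + t) C k) + t * ((m + t) C k))
      ≡⟨ cong (m C suc k +_) (*-distribʳ-+ ((m + t) C k) m t) ⟨
    m C suc k + (m + t) * ((m + t) C k) ∎
    where open ≤-Reasoning

  -- (1+k)·C(n,1+k) = (n−k)·C(n,k), stated without truncated subtraction.
  [1+k]*nC[1+k]+k*nCk≡n*nCk : ∀ n k → suc k * (n C suc k) + k * (n C k) ≡ n * (n C k)
  [1+k]*nC[1+k]+k*nCk≡n*nCk zero    zero    = refl
  [1+k]*nC[1+k]+k*nCk≡n*nCk zero    (suc k) = cong₂ _+_ (*-zeroʳ (suc (suc k))) (*-zeroʳ (suc k))
  [1+k]*nC[1+k]+k*nCk≡n*nCk (suc n) zero    rewrite nC1≡n (suc n) = solve (n ∷ [])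
  [1+k]*nC[1+k]+k*nCk≡n*nCk (suc n) (suc k) = begin
    suc (suc k) * (suc n C suc (suc k)) + suc k * (suc n C suc k)
      ≡⟨ cong₂ (λ x y → suc (suc k) * x + suc k * y)
               (nCk+nC[k+1]≡[n+1]C[k+1] n (suc k)) (nCk+nC[k+1]≡[n+1]C[k+1] n k) ⟨
    suc (suc k) * (n C suc k + n C suc (suc k)) + suc k * (n C k + n C suc k)
      ≡⟨ step (n C k) (n C suc k) (n C suc (suc k))
              ([1+k]*nC[1+k]+k*nCk≡n*nCk n (suc k)) ([1+k]*nC[1+k]+k*nCk≡n*nCk n k) ⟩
    suc n * (n C k + n C suc k)
      ≡⟨ cong (suc n *_) (nCk+nC[k+1]≡[n+1]C[k+1] n k) ⟩
    suc n * (suc n C suc k) ∎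
    where
    open ≡-Reasoning
    step : ∀ a b c → suc (suc k) * c + suc k * b ≡ n * b → suc k * b + k * a ≡ n * a →
           suc (suc k) * (b + c) + suc k * (a + b) ≡ suc n * (a + b)
    step a b c ih₁ ih₂ = begin
      suc (suc k) * (b + c) + suc k * (a + b)
        ≡⟨ solve (a ∷ b ∷ c ∷ k ∷ []) ⟩
      (suc (suc k) * c + suc k * b) + (suc k * b + k * a) + (a + b)
        ≡⟨ cong₂ (λ x y → x + y + (a + b)) ih₁ ih₂ ⟩
      n * b + n * a + (a + b)
        ≡⟨ solve (a ∷ b ∷ n ∷ []) ⟩
      suc n * (a + b) ∎

  C-linear-lower-bound : ∀ n m k → suc k * (n C k) * m ≤ suc k * (m C suc k) + (n C k) * (k * (n + 1))
  C-linear-lower-bound n m k = clear (n C suc k) (n C k) (m C suc k)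
    ([1+k]*nC[1+k]+k*nCk≡n*nCk n k) (nC[1+k]+m*nCk≤mC[1+k]+n*nCk n m k)
    where
    open ≤-Reasoning
    clear : ∀ a c e → suc k * a + k * c ≡ n * c → a + m * c ≤ e + n * c →
            suc k * c * m ≤ suc k * e + c * (k * (n + 1))
    clear a c e absorption line = +-cancelʳ-≤ (suc k * a) _ _ (begin
      suc k * c * m + suc k * a                    ≡⟨ solve (a ∷ c ∷ k ∷ m ∷ []) ⟩
      suc k * (a + m * c)                          ≤⟨ *-monoʳ-≤ (suc k) line ⟩
      suc k * (e + n * c)                          ≡⟨ solve (c ∷ e ∷ k ∷ n ∷ []) ⟩
      suc k * e + n * c + k * n * c                ≡⟨ cong (λ x → suc k * e + x + k * n * c) absorption ⟨
      suc k * e + (suc k * a + k * c) + k * n * c  ≡⟨ solve (a ∷ c ∷ e ∷ k ∷ n ∷ []) ⟩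
      suc k * e + c * (k * (n + 1)) + suc k * a    ∎)

module IntersectionSums where

  open import Defs
  open import Level using (Level)
  open import Data.Bool using (Bool; true; false; _∧_)
  open import Data.Bool.ListAction using (all; and)
  open import Data.Nat using (ℕ; zero; suc; _+_; _*_; _≤_; _≟_; z≤n)
  open import Data.Nat.Properties
    using (+-comm; +-identityʳ; *-zeroʳ; *-distribˡ-+; +-mono-≤; +-commutativeSemigroup; module ≤-Reasoning)
  open import Algebra.Properties.CommutativeSemigroup +-commutativeSemigroup using (interchange)
  open import Data.Nat.Combinatorics using (_C_; nCk+nC[k+1]≡[n+1]C[k+1]; nC1≡n)
  open import Data.Nat.ListAction using (sum)
  open import Data.Nat.ListAction.Properties using (sum-++)
  open import Data.Nat.Tactic.RingSolver using (solve-∀)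
  open import Data.Fin using (Fin; zero; suc)
  open import Data.Fin.Subset using (Subset; ⋂; ∣_∣; outside; inside; _∩_)
  open import Data.Fin.Subset.Properties using (_∈?_; _⊆?_)
  import Data.List as List
  open import Data.List using (List; []; _∷_; map; filter; allFin; _++_)
  open import Data.List.Properties
    using (map-∘; map-cong; map-++; map-tabulate; filter-++; filter-none; ++-identityʳ)
  open import Data.List.Relation.Unary.All using (universal)
  open import Data.List.Relation.Unary.All.Properties using (map⁺)
  open import Data.Vec using (head; tail; tabulate; _∷_; [])
  open import Function using (_∘_; id)
  open import Relation.Nullary using (does)
  open import Relation.Unary using (Pred; Decidable)
  open import Relation.Binary.PropositionalEquality
  open BinomialCoefficients using (C-linear-lower-bound)

  private variable
    a p q : Level
    X Y : Set a
    n r : ℕ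

  𝟙 : Bool → ℕ
  𝟙 true  = 1
  𝟙 false = 0

  𝟙[_⊆_] : Subset r → Subset r → ℕ
  𝟙[ I ⊆ D ] = 𝟙 (does (I ⊆? D))

  sum-map-+ : (f g : X → ℕ) (xs : List X) →
    sum (map (λ x → f x + g x) xs) ≡ sum (map f xs) + sum (map g xs)
  sum-map-+ f g []       = refl
  sum-map-+ f g (x ∷ xs) = begin
    f x + g x + sum (map (λ x → f x + g x) xs)     ≡⟨ cong (f x + g x +_) (sum-map-+ f g xs) ⟩
    f x + g x + (sum (map f xs) + sum (map g xs))  ≡⟨ interchange (f x) (g x) (sum (map f xs)) (sum (map g xs)) ⟩
    f x + sum (map f xs) + (g x + sum (map g xs))  ∎
    where open ≡-Reasoning

  sum-map-0 : (xs : List X) → sum (map (λ _ → 0) xs) ≡ 0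
  sum-map-0 []       = refl
  sum-map-0 (x ∷ xs) = sum-map-0 xs

  sum-map-∘ : (f : Y → ℕ) (g : X → Y) (xs : List X) → sum (map f (map g xs)) ≡ sum (map (f ∘ g) xs)
  sum-map-∘ f g xs = cong sum (sym (map-∘ xs))

  all-map : (p : Y → Bool) (f : X → Y) (xs : List X) → all p (map f xs) ≡ all (p ∘ f) xs
  all-map p f xs = cong and (sym (map-∘ xs))

  filter-map : {P : Pred Y p} {Q : Pred X q} {P? : Decidable P} {Q? : Decidable Q} (f : X → Y) →
               (∀ x → does (P? (f x)) ≡ does (Q? x)) →
               ∀ xs → filter P? (map f xs) ≡ map f (filter Q? xs)
  filter-map f same [] = refl
  filter-map {Q? = Q?} f same (x ∷ xs) rewrite same x with does (Q? x)
  ... | true  = cong (f x ∷_) (filter-map f same xs)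
  ... | false = filter-map f same xs

  subsetsOfSize-zero : ∀ r → subsetsOfSize (suc r) 0 ≡ map (outside ∷_) (subsetsOfSize r 0)
  subsetsOfSize-zero r = begin
    filter P? (map (outside ∷_) Xs ++ map (inside ∷_) Xs)
      ≡⟨ filter-++ P? (map (outside ∷_) Xs) _ ⟩
    filter P? (map (outside ∷_) Xs) ++ filter P? (map (inside ∷_) Xs)
      ≡⟨ cong₂ _++_ (filter-map (outside ∷_) (λ _ → refl) Xs)
                    (filter-none P? (map⁺ (universal (λ _ ()) Xs))) ⟩
    map (outside ∷_) (subsetsOfSize r 0) ++ []
      ≡⟨ ++-identityʳ _ ⟩
    map (outside ∷_) (subsetsOfSize r 0) ∎
    where
    open ≡-Reasoning
    P? : Decidable (λ (I : Subset (suc r)) → ∣ I ∣ ≡ 0)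
    P? I = ∣ I ∣ ≟ 0
    Xs : List (Subset r)
    Xs = allSubsets r

  subsetsOfSize-suc : ∀ r k → subsetsOfSize (suc r) (suc k) ≡
                      map (outside ∷_) (subsetsOfSize r (suc k)) ++ map (inside ∷_) (subsetsOfSize r k)
  subsetsOfSize-suc r k = trans (filter-++ (λ I → ∣ I ∣ ≟ suc k) (map (outside ∷_) (allSubsets r)) _)
    (cong₂ _++_ (filter-map (outside ∷_) (λ _ → refl) (allSubsets r))
                (filter-map (inside ∷_) (λ _ → refl) (allSubsets r)))

  sum-subsetsOfSize-zero : (f : Subset (suc r) → ℕ) →
    sum (map f (subsetsOfSize (suc r) 0)) ≡ sum (map (f ∘ (outside ∷_)) (subsetsOfSize r 0))
  sum-subsetsOfSize-zero {r} f =
    trans (cong (sum ∘ map f) (subsetsOfSize-zero r)) (sum-map-∘ f (outside ∷_) (subsetsOfSize r 0))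

  sum-subsetsOfSize-suc : ∀ k (f : Subset (suc r) → ℕ) →
    sum (map f (subsetsOfSize (suc r) (suc k))) ≡
    sum (map (f ∘ (outside ∷_)) (subsetsOfSize r (suc k))) + sum (map (f ∘ (inside ∷_)) (subsetsOfSize r k))
  sum-subsetsOfSize-suc {r} k f = begin
    sum (map f (subsetsOfSize (suc r) (suc k)))
      ≡⟨ cong (sum ∘ map f) (subsetsOfSize-suc r k) ⟩
    sum (map f (map (outside ∷_) Out ++ map (inside ∷_) In))
      ≡⟨ cong sum (map-++ f (map (outside ∷_) Out) _) ⟩
    sum (map f (map (outside ∷_) Out) ++ map f (map (inside ∷_) In))
      ≡⟨ sum-++ (map f (map (outside ∷_) Out)) _ ⟩
    sum (map f (map (outside ∷_) Out)) + sum (map f (map (inside ∷_) In))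
      ≡⟨ cong₂ _+_ (sum-map-∘ f (outside ∷_) Out) (sum-map-∘ f (inside ∷_) In) ⟩
    sum (map (f ∘ (outside ∷_)) Out) + sum (map (f ∘ (inside ∷_)) In) ∎
    where
    open ≡-Reasoning
    Out In : List (Subset r)
    Out = subsetsOfSize r (suc k)
    In  = subsetsOfSize r k

  count-⊆-subsetsOfSize : ∀ r k (D : Subset r) → sum (map 𝟙[_⊆ D ] (subsetsOfSize r k)) ≡ ∣ D ∣ C k
  count-⊆-subsetsOfSize zero    zero    [] = refl
  count-⊆-subsetsOfSize zero    (suc k) [] = refl
  count-⊆-subsetsOfSize (suc r) zero    (b ∷ D) =
    trans (sum-subsetsOfSize-zero 𝟙[_⊆ b ∷ D ]) (count-⊆-subsetsOfSize r zero D)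
  count-⊆-subsetsOfSize (suc r) (suc k) (inside ∷ D) = begin
    sum (map 𝟙[_⊆ inside ∷ D ] (subsetsOfSize (suc r) (suc k)))
      ≡⟨ sum-subsetsOfSize-suc k 𝟙[_⊆ inside ∷ D ] ⟩
    sum (map 𝟙[_⊆ D ] (subsetsOfSize r (suc k))) + sum (map 𝟙[_⊆ D ] (subsetsOfSize r k))
      ≡⟨ cong₂ _+_ (count-⊆-subsetsOfSize r (suc k) D) (count-⊆-subsetsOfSize r k D) ⟩
    ∣ D ∣ C suc k + ∣ D ∣ C k
      ≡⟨ +-comm (∣ D ∣ C suc k) (∣ D ∣ C k) ⟩
    ∣ D ∣ C k + ∣ D ∣ C suc k
      ≡⟨ nCk+nC[k+1]≡[n+1]C[k+1] ∣ D ∣ k ⟩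
    suc ∣ D ∣ C suc k ∎
    where open ≡-Reasoning
  count-⊆-subsetsOfSize (suc r) (suc k) (outside ∷ D) = begin
    sum (map 𝟙[_⊆ outside ∷ D ] (subsetsOfSize (suc r) (suc k)))
      ≡⟨ sum-subsetsOfSize-suc k 𝟙[_⊆ outside ∷ D ] ⟩
    sum (map 𝟙[_⊆ D ] (subsetsOfSize r (suc k))) + sum (map (λ _ → 0) (subsetsOfSize r k))
      ≡⟨ cong₂ _+_ (count-⊆-subsetsOfSize r (suc k) D) (sum-map-0 (subsetsOfSize r k)) ⟩
    ∣ D ∣ C suc k + 0
      ≡⟨ +-identityʳ (∣ D ∣ C suc k) ⟩
    ∣ D ∣ C suc k ∎
    where open ≡-Reasoning

  filter-∈?-∷ : ∀ b (I : Subset r) → filter (_∈? (b ∷ I)) (List.tabulate suc) ≡ map suc (members I)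
  filter-∈?-∷ {r} b I = trans (cong (filter (_∈? (b ∷ I))) (sym (map-tabulate {n = r} id suc)))
                              (filter-map suc (λ _ → refl) (allFin r))

  members-outside : (I : Subset r) → members (outside ∷ I) ≡ map suc (members I)
  members-outside = filter-∈?-∷ outside

  members-inside : (I : Subset r) → members (inside ∷ I) ≡ zero ∷ map suc (members I)
  members-inside I = cong (zero ∷_) (filter-∈?-∷ inside I)

  inside∷-⊆?-∷ : ∀ b (I D : Subset r) → does ((inside ∷ I) ⊆? (b ∷ D)) ≡ b ∧ does (I ⊆? D)
  inside∷-⊆?-∷ true  I D = refl
  inside∷-⊆?-∷ false I D = refl

  all-members : (p : Fin r → Bool) (I : Subset r) → all p (members I) ≡ does (I ⊆? tabulate p)
  all-members p [] = refl
  all-members p (outside ∷ I) = begin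
    all p (members (outside ∷ I))   ≡⟨ cong (all p) (members-outside I) ⟩
    all p (map suc (members I))     ≡⟨ all-map p suc (members I) ⟩
    all (p ∘ suc) (members I)       ≡⟨ all-members (p ∘ suc) I ⟩
    does (I ⊆? tabulate (p ∘ suc))  ∎
    where open ≡-Reasoning
  all-members p (inside ∷ I) = begin
    all p (members (inside ∷ I))             ≡⟨ cong (all p) (members-inside I) ⟩
    p zero ∧ all p (map suc (members I))     ≡⟨ cong (p zero ∧_) (all-map p suc (members I)) ⟩
    p zero ∧ all (p ∘ suc) (members I)       ≡⟨ cong (p zero ∧_) (all-members (p ∘ suc) I) ⟩
    p zero ∧ does (I ⊆? tabulate (p ∘ suc))  ≡⟨ inside∷-⊆?-∷ (p zero) I (tabulate (p ∘ suc)) ⟨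
    does ((inside ∷ I) ⊆? tabulate p)        ∎
    where open ≡-Reasoning

  head-∩ : (u v : Subset (suc n)) → head (u ∩ v) ≡ head u ∧ head v
  head-∩ (x ∷ u) (y ∷ v) = refl

  tail-∩ : (u v : Subset (suc n)) → tail (u ∩ v) ≡ tail u ∩ tail v
  tail-∩ (x ∷ u) (y ∷ v) = refl

  head-⋂ : (vs : List (Subset (suc n))) → head (⋂ vs) ≡ and (map head vs)
  head-⋂ []       = refl
  head-⋂ (v ∷ vs) = trans (head-∩ v (⋂ vs)) (cong (head v ∧_) (head-⋂ vs))

  tail-⋂ : (vs : List (Subset (suc n))) → tail (⋂ vs) ≡ ⋂ (map tail vs)
  tail-⋂ []       = refl
  tail-⋂ (v ∷ vs) = trans (tail-∩ v (⋂ vs)) (cong (tail v ∩_) (tail-⋂ vs))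

  ∣∣-head-tail : (v : Subset (suc n)) → ∣ v ∣ ≡ 𝟙 (head v) + ∣ tail v ∣
  ∣∣-head-tail (inside  ∷ v) = refl
  ∣∣-head-tail (outside ∷ v) = refl

  ∣∣-empty : (v : Subset 0) → ∣ v ∣ ≡ 0
  ∣∣-empty [] = refl

  head-interAt : (A : Fin r → Subset (suc n)) (I : Subset r) →
    head (interAt A I) ≡ does (I ⊆? tabulate (head ∘ A))
  head-interAt A I = begin
    head (⋂ (map A (members I)))        ≡⟨ head-⋂ (map A (members I)) ⟩
    and (map head (map A (members I)))  ≡⟨ all-map head A (members I) ⟩
    all (head ∘ A) (members I)          ≡⟨ all-members (head ∘ A) I ⟩
    does (I ⊆? tabulate (head ∘ A))     ∎
    where open ≡-Reasoning

  tail-interAt : (A : Fin r → Subset (suc n)) (I : Subset r) → tail (interAt A I) ≡ interAt (tail ∘ A) I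
  tail-interAt A I = trans (tail-⋂ (map A (members I))) (cong ⋂ (sym (map-∘ (members I))))

  ∣interAt∣-head-tail : (A : Fin r → Subset (suc n)) (I : Subset r) →
    ∣ interAt A I ∣ ≡ 𝟙[ I ⊆ tabulate (head ∘ A) ] + ∣ interAt (tail ∘ A) I ∣
  ∣interAt∣-head-tail A I = trans (∣∣-head-tail (interAt A I))
    (cong₂ _+_ (cong 𝟙 (head-interAt A I)) (cong ∣_∣ (tail-interAt A I)))

  -- tabulate (head ∘ A) is the set of indices i with the first point in A i; its size is
  -- the degree d(x) of that point.
  S-head-tail : (A : Fin r → Subset (suc n)) (k : ℕ) →
    S A k ≡ ∣ tabulate (head ∘ A) ∣ C k + S (tail ∘ A) k
  S-head-tail {r} A k = begin
    S A k
      ≡⟨ cong sum (map-cong (∣interAt∣-head-tail A) (subsetsOfSize r k)) ⟩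
    sum (map (λ I → 𝟙[ I ⊆ D ] + ∣ interAt (tail ∘ A) I ∣) (subsetsOfSize r k))
      ≡⟨ sum-map-+ 𝟙[_⊆ D ] (λ I → ∣ interAt (tail ∘ A) I ∣) (subsetsOfSize r k) ⟩
    sum (map 𝟙[_⊆ D ] (subsetsOfSize r k)) + S (tail ∘ A) k
      ≡⟨ cong (_+ S (tail ∘ A) k) (count-⊆-subsetsOfSize r k D) ⟩
    ∣ D ∣ C k + S (tail ∘ A) k ∎
    where
    open ≡-Reasoning
    D : Subset r
    D = tabulate (head ∘ A)

  S-empty : (A : Fin r → Subset 0) (k : ℕ) → S A k ≡ 0
  S-empty {r} A k = trans (cong sum (map-cong (∣∣-empty ∘ interAt A) (subsetsOfSize r k)))
                          (sum-map-0 (subsetsOfSize r k))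

  S-linear-lower-bound : ∀ q k (A : Fin r → Subset n) →
    suc k * (q C k) * S A 1 ≤ suc k * S A (suc k) + (q C k) * (k * (q + 1) * n)
  S-linear-lower-bound {n = zero} q k A rewrite S-empty A 1 | *-zeroʳ (suc k * (q C k)) = z≤n
  S-linear-lower-bound {n = suc n} q k A = begin
    suc k * c * S A 1
      ≡⟨ cong (suc k * c *_) (trans (S-head-tail A 1) (cong (_+ S A′ 1) (nC1≡n d))) ⟩
    suc k * c * (d + S A′ 1)
      ≡⟨ *-distribˡ-+ (suc k * c) d (S A′ 1) ⟩
    suc k * c * d + suc k * c * S A′ 1
      ≤⟨ +-mono-≤ (C-linear-lower-bound q d k) (S-linear-lower-bound q k A′) ⟩
    (suc k * (d C suc k) + c * (k * (q + 1))) + (suc k * S A′ (suc k) + c * (k * (q + 1) * n))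
      ≡⟨ collect (suc k) (d C suc k) (S A′ (suc k)) c (k * (q + 1)) n ⟩
    suc k * (d C suc k + S A′ (suc k)) + c * (k * (q + 1) * suc n)
      ≡⟨ cong (λ x → suc k * x + c * (k * (q + 1) * suc n)) (S-head-tail A (suc k)) ⟨
    suc k * S A (suc k) + c * (k * (q + 1) * suc n) ∎
    where
    open ≤-Reasoning
    c d : ℕ
    c = q C k
    d = ∣ tabulate (head ∘ A) ∣
    A′ : Fin _ → Subset n
    A′ = tail ∘ A
    collect : ∀ K e s c B n → (K * e + c * B) + (K * s + c * (B * n)) ≡ K * (e + s) + c * (B * suc n)
    collect = solve-∀

module ClearingDenominators where

  open import Data.Nat using (ℕ; suc; _+_; _*_; _≤_)
  open import Data.Nat.Properties using (*-identityʳ; +-identityʳ)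
  open import Data.Integer using (ℤ; +_; +≤+)
  import Data.Integer as ℤ
  import Data.Integer.Properties as ℤ
  open import Data.Integer.Tactic.RingSolver using (solve-∀)
  import Data.Rational as ℚ
  open ℚ using (toℚᵘ) renaming (_/_ to _÷ℤ_)
  import Data.Rational.Properties as ℚ
  open import Data.Rational.Unnormalised using (ℚᵘ; mkℚᵘ; *≤*; _≃_)
  import Data.Rational.Unnormalised as ℚᵘ
  import Data.Rational.Unnormalised.Properties as ℚᵘ
  open import Function using (_∘_)
  open import Relation.Binary.PropositionalEquality

  -- Unnormalised arithmetic leaves the denominator 1 + j in the unreduced forms
  -- 1 + j·1·1 and 1 + (j·1·1 + 0 + 0), hence the parameters d and e.
  ℤ-cleared-bound : ∀ c s t j Q N {d e : ℤ} → d ≡ + suc j → e ≡ + suc j →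
    suc j * c * s ≤ suc j * t + c * (j * Q * N) →
    (+ c ℤ.* (+ s ℤ.* d ℤ.+ ℤ.- (+ j ℤ.* + Q ℤ.* + N) ℤ.* + 1)) ℤ.* + 1 ℤ.≤ + t ℤ.* e
  ℤ-cleared-bound c s t j Q N refl refl h = begin
    (+ c ℤ.* (+ s ℤ.* + suc j ℤ.+ ℤ.- (+ j ℤ.* + Q ℤ.* + N) ℤ.* + 1)) ℤ.* + 1
      ≡⟨ expand (+ c) (+ s) (+ suc j) (+ j ℤ.* + Q ℤ.* + N) ⟩
    + suc j ℤ.* + c ℤ.* + s ℤ.- + c ℤ.* (+ j ℤ.* + Q ℤ.* + N)
      ≡⟨ cong₂ (λ x y → x ℤ.- + c ℤ.* y) (pos-*³ (suc j) c s) (pos-*³ j Q N) ⟨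
    + (suc j * c * s) ℤ.- + c ℤ.* + (j * Q * N)
      ≡⟨ cong (λ x → + (suc j * c * s) ℤ.- x) (ℤ.pos-* c (j * Q * N)) ⟨
    + (suc j * c * s) ℤ.- + X
      ≤⟨ ℤ.+-monoˡ-≤ (ℤ.- + X) (+≤+ h) ⟩
    + (suc j * t + X) ℤ.- + X
      ≡⟨ cong (ℤ._- + X) (trans (ℤ.pos-+ (suc j * t) X) (cong (ℤ._+ + X) (ℤ.pos-* (suc j) t))) ⟩
    + suc j ℤ.* + t ℤ.+ + X ℤ.- + X
      ≡⟨ cancel (+ suc j) (+ t) (+ X) ⟩
    + t ℤ.* + suc j ∎
    where
    open ℤ.≤-Reasoning
    X : ℕ
    X = c * (j * Q * N)
    pos-*³ : ∀ a b c → + (a * b * c) ≡ + a ℤ.* + b ℤ.* + c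
    pos-*³ a b c = trans (ℤ.pos-* (a * b) c) (cong (ℤ._* + c) (ℤ.pos-* a b))
    expand : ∀ C S J Y → (C ℤ.* (S ℤ.* J ℤ.+ ℤ.- Y ℤ.* + 1)) ℤ.* + 1 ≡ J ℤ.* C ℤ.* S ℤ.- C ℤ.* Y
    expand = solve-∀
    cancel : ∀ J T Y → J ℤ.* T ℤ.+ Y ℤ.- Y ≡ T ℤ.* J
    cancel = solve-∀

  ⟦_⟧ : ℕ → ℚᵘ
  ⟦ n ⟧ = mkℚᵘ (+ n) 0

  ℚᵘ-cleared-bound : ∀ c s t j Q N → suc j * c * s ≤ suc j * t + c * (j * Q * N) →
    ⟦ c ⟧ ℚᵘ.* (⟦ s ⟧ ℚᵘ.- mkℚᵘ (+ j) j ℚᵘ.* ⟦ Q ⟧ ℚᵘ.* ⟦ N ⟧) ℚᵘ.≤ ⟦ t ⟧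
  ℚᵘ-cleared-bound c s t j Q N h =
    *≤* (ℤ-cleared-bound c s t j Q N (cong (+_ ∘ suc) j·1·1≡j) (cong (+_ ∘ suc) j·1·1+0+0≡j) h)
    where
    j·1·1≡j : j * 1 * 1 ≡ j
    j·1·1≡j = trans (*-identityʳ (j * 1)) (*-identityʳ j)
    j·1·1+0+0≡j : j * 1 * 1 + 0 + 0 ≡ j
    j·1·1+0+0≡j = trans (+-identityʳ (j * 1 * 1 + 0)) (trans (+-identityʳ (j * 1 * 1)) j·1·1≡j)

  toℚᵘ-/ : ∀ n d → toℚᵘ (+ n ÷ℤ suc d) ≃ mkℚᵘ (+ n) d
  toℚᵘ-/ n d = ℚ.toℚᵘ-fromℚᵘ (mkℚᵘ (+ n) d)

  toℚᵘ-* : ∀ {p q p′ q′} → toℚᵘ p ≃ p′ → toℚᵘ q ≃ q′ → toℚᵘ (p ℚ.* q) ≃ p′ ℚᵘ.* q′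
  toℚᵘ-* {p} {q} p≃p′ q≃q′ = ℚᵘ.≃-trans (ℚ.toℚᵘ-homo-* p q) (ℚᵘ.*-cong p≃p′ q≃q′)

  toℚᵘ-minus : ∀ {p q p′ q′} → toℚᵘ p ≃ p′ → toℚᵘ q ≃ q′ → toℚᵘ (p ℚ.- q) ≃ p′ ℚᵘ.- q′
  toℚᵘ-minus {p} {q} p≃p′ q≃q′ = ℚᵘ.≃-trans (ℚ.toℚᵘ-homo-+ p (ℚ.- q))
    (ℚᵘ.+-cong p≃p′ (ℚᵘ.≃-trans (ℚ.toℚᵘ-homo‿- q) (ℚᵘ.-‿cong q≃q′)))

  ℚ-cleared-bound : ∀ c s t j Q N → suc j * c * s ≤ suc j * t + c * (j * Q * N) →
    (+ c ÷ℤ 1) ℚ.* ((+ s ÷ℤ 1) ℚ.- ((+ j ÷ℤ suc j) ℚ.* (+ Q ÷ℤ 1) ℚ.* (+ N ÷ℤ 1))) ℚ.≤ (+ t ÷ℤ 1)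
  ℚ-cleared-bound c s t j Q N h = ℚ.toℚᵘ-cancel-≤ (begin
    toℚᵘ ((+ c ÷ℤ 1) ℚ.* ((+ s ÷ℤ 1) ℚ.- ((+ j ÷ℤ suc j) ℚ.* (+ Q ÷ℤ 1) ℚ.* (+ N ÷ℤ 1))))
      ≃⟨ toℚᵘ-* (toℚᵘ-/ c 0)
                (toℚᵘ-minus (toℚᵘ-/ s 0) (toℚᵘ-* (toℚᵘ-* (toℚᵘ-/ j j) (toℚᵘ-/ Q 0)) (toℚᵘ-/ N 0))) ⟩
    ⟦ c ⟧ ℚᵘ.* (⟦ s ⟧ ℚᵘ.- mkℚᵘ (+ j) j ℚᵘ.* ⟦ Q ⟧ ℚᵘ.* ⟦ N ⟧)
      ≤⟨ ℚᵘ-cleared-bound c s t j Q N h ⟩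
    ⟦ t ⟧
      ≃⟨ toℚᵘ-/ t 0 ⟨
    toℚᵘ (+ t ÷ℤ 1) ∎)
    where open ℚᵘ.≤-Reasoning

open import Defs
open import Data.Nat using (ℕ; suc; _≤_; _/_; _+_)
open import Data.Nat.Combinatorics using (_C_)
open import Data.Fin using (Fin)
open import Data.Fin.Subset using (Subset)
open import Data.Integer using (+_)
open import Data.Rational using (ℚ; _*_; _-_) renaming (_≤_ to _≤ℚ_; _/_ to _÷ℤ_)
open IntersectionSums using (S-linear-lower-bound)
open ClearingDenominators using (ℚ-cleared-bound)

theorem3 : (r m : ℕ) → 3 ≤ r → (A : Fin r → Subset (suc m)) →
    (j : ℕ) → suc j ≤ r →
      ((+ ((S A 1 / suc m) C j)) ÷ℤ 1)
        * ((+ S A 1 ÷ℤ 1) - ((+ j ÷ℤ suc j) * (+ ((S A 1 / suc m) + 1) ÷ℤ 1) * (+ suc m ÷ℤ 1)))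
        ≤ℚ (+ S A (suc j) ÷ℤ 1)
theorem3 r m _ A j _ =
  ℚ-cleared-bound (q C j) (S A 1) (S A (suc j)) j (q + 1) (suc m) (S-linear-lower-bound q j A)
  where
  q : ℕ
  q = S A 1 / suc m
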